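{- Let $K_{m,n}$ be the complete bipartite graph with parts $V_1,V_2$, where $|V_1|=m$, $|V_2|=n$ and $m>n$. Then the $p$-influencing set of $K_{m,n}$ is (i) $V_1\cup V_2$ for $0<p\leq \frac{n+1}{m+n}$ and for $\frac{m+2}{m+n}\le p\le 1$; (ii) $V_2$ for $\frac{n+2}{m+n}\leq p\leq \frac{m+1}{m+n}$. Moreover, if $m=n$, then the $p$-influencing set of $K_{m,n}$ is $V_1\cup V_2$ for all $p\in(0,1]$.
   Context: $N[v]$ is the closed neighborhood of $v$ and $N[S]=\bigcup_{u\in S}N[u]$. For $p\in[0,1]$, a set $S\subseteq V$ is a $p$-dominating set if $|N[S]|/|V|\geq p$; $\gamma_p(G)$ is the minimum cardinality of a $p$-dominating set; a $\gamma_p$-set is a $p$-dominating set of cardinality $\gamma_p(G)$. The $p$-influencing set of $G$ is the union of all $\gamma_p$-sets of $G$.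
   Formalization: The parameter p takes only rational values rather than all values in $[0,1]$. -}

module Defs where

open import Data.Bool using (Bool; true; false; _∧_; _∨_; _xor_)
open import Data.Nat using (ℕ; zero; suc; _+_; _<ᵇ_; _≡ᵇ_)
import Data.Nat as ℕ
open import Data.Fin using (Fin; toℕ)
open import Data.Fin.Subset using (Subset; _∈_; ∣_∣)
open import Data.Vec using (tabulate; lookup)
open import Data.Bool.ListAction using (any)
open import Data.List using (allFin)
open import Data.Integer using (+_)
open import Data.Rational using (ℚ; _/_; 0ℚ; _≤_)
open import Data.Product using (Σ; _×_)

Graph : ℕ → Set
Graph N = Fin N → Fin N → Bool

-- Complete bipartite graph K_{m,n} on Fin (m + n):
-- V₁ = vertices with index < m  (|V₁| = m), V₂ = vertices with index ≥ m (|V₂| = n).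
inV₁ᵇ : (m : ℕ) {N : ℕ} → Fin N → Bool
inV₁ᵇ m v = toℕ v <ᵇ m

InV₁ : (m n : ℕ) → Fin (m + n) → Set
InV₁ m n v = toℕ v ℕ.< m

InV₂ : (m n : ℕ) → Fin (m + n) → Set
InV₂ m n v = m ℕ.≤ toℕ v

K : (m n : ℕ) → Graph (m + n)
K m n u v = inV₁ᵇ m u xor inV₁ᵇ m v

closedNbhd : {N : ℕ} → Graph N → Subset N → Subset N
closedNbhd {N} G S =
  tabulate λ v → any (λ u → lookup S u ∧ ((toℕ u ≡ᵇ toℕ v) ∨ G u v)) (allFin N)

-- k / N as a rational number (N = |V| ≥ 1 in all uses; the value at N = 0 is irrelevant).
frac : ℕ → ℕ → ℚ
frac k zero = 0ℚ
frac k (suc N) = (+ k) / suc N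

PDominating : {N : ℕ} → Graph N → ℚ → Subset N → Set
PDominating {N} G p S = p ≤ frac ∣ closedNbhd G S ∣ N

GammaPSet : {N : ℕ} → Graph N → ℚ → Subset N → Set
GammaPSet {N} G p S =
  PDominating G p S × ((T : Subset N) → PDominating G p T → ∣ S ∣ ℕ.≤ ∣ T ∣)

InInfluencing : {N : ℕ} → Graph N → ℚ → Fin N → Set
InInfluencing {N} G p v = Σ (Subset N) λ S → GammaPSet G p S × v ∈ S

{-# OPTIONS --safe #-}
-- In K_{m,n} the closed neighbourhood of a vertex of V₁ has 1 + n vertices, that of a vertex of V₂
-- has m + 1, and every pair {x ∈ V₁, y ∈ V₂} dominates the whole graph.  Hence for
-- 0 < p ≤ (n+1)/(m+n) every singleton is a γ_p-set; for p > (m+1)/(m+n) no singleton is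
-- p-dominating, so γ_p = 2 and every vertex lies in such a pair; and for
-- (n+2)/(m+n) ≤ p ≤ (m+1)/(m+n) the singletons of V₂ are p-dominating while those of V₁ are not,
-- so the γ_p-sets are exactly the singletons of V₂.  When m = n every p ∈ (0,1] falls under the
-- first or the second case.

module Submission where

open import Defs
open import Data.Bool using (Bool; true; false; _∨_; _xor_)
open import Data.Bool.Properties using (T-≡; T-∧; ∨-identityʳ; ∨-zeroʳ; ¬-not)
open import Data.Empty using (⊥-elim)
open import Data.Fin using (Fin; zero; suc; toℕ; _↑ˡ_; _↑ʳ_; splitAt)
open import Data.Fin.Properties using (toℕ-↑ˡ; toℕ-↑ʳ; toℕ<n; splitAt⁻¹-↑ˡ; splitAt⁻¹-↑ʳ; _≟_)
open import Data.Fin.Subset using (Subset; _∈_; _⊆_; ∣_∣; ⁅_⁆; ⊤; _∪_; Empty)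
open import Data.Fin.Subset.Properties
  using (x∈⁅x⁆; x∈⁅y⁆⇒x≡y; x≢y⇒x∉⁅y⁆; ∣⁅x⁆∣≡1; ∣⊤∣≡n; ∣⊥∣≡0; ⊆⊤; ⊆-antisym; Empty-unique;
         nonempty?; p⊆q⇒∣p∣≤∣q∣; p⊂q⇒∣p∣<∣q∣; x∈p∪q⁺)
open import Data.List using (allFin)
open import Data.List.Relation.Unary.Any using (satisfied)
open import Data.List.Relation.Unary.Any.Properties using (any⁺; any⁻; tabulate⁺)
open import Data.Nat using (ℕ; zero; suc; _+_; _≡ᵇ_; z≤n; s≤s)
import Data.Nat as ℕ
import Data.Nat.Properties as ℕ
open import Data.Product using (∃; _×_; _,_)
open import Data.Rational using (ℚ; 0ℚ; 1ℚ; _<_; _≤_; toℚᵘ)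
import Data.Rational.Properties as ℚ
open import Data.Rational.Unnormalised using (mkℚᵘ; _≃_; *≡*; *≤*)
import Data.Rational.Unnormalised.Properties as ℚᵘ
open import Data.Integer using (+_; +≤+; drop‿+≤+)
import Data.Integer.Properties as ℤ
open import Data.Sum using (_⊎_; inj₁; inj₂)
open import Data.Vec using ([]; _∷_; tabulate; replicate; _++_)
open import Data.Vec.Properties
  using (lookup∘tabulate; tabulate-cong; tabulate-∘; map-const; []=⇒lookup; lookup⇒[]=)
open import Function using (_∘_; const)
open import Function.Bundles using (_⇔_; mk⇔; Equivalence)
open import Relation.Binary.PropositionalEquality
open import Relation.Nullary using (¬_; yes; no)

open Equivalence using (to; from)

toℚᵘ-frac : ∀ a N → toℚᵘ (frac a (suc N)) ≃ mkℚᵘ (+ a) N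
toℚᵘ-frac a N = ℚ.toℚᵘ-fromℚᵘ (mkℚᵘ (+ a) N)

frac-mono-≤ : ∀ N {a b} → a ℕ.≤ b → frac a N ≤ frac b N
frac-mono-≤ zero    a≤b = ℚ.≤-refl
frac-mono-≤ (suc N) {a} {b} a≤b = ℚ.toℚᵘ-cancel-≤
  (ℚᵘ.≤-respʳ-≃ (ℚᵘ.≃-sym (toℚᵘ-frac b N)) (ℚᵘ.≤-respˡ-≃ (ℚᵘ.≃-sym (toℚᵘ-frac a N))
    (*≤* (ℤ.*-monoʳ-≤-nonNeg (+ suc N) (+≤+ a≤b)))))

frac-cancel-≤ : ∀ N {a b} → frac a (suc N) ≤ frac b (suc N) → a ℕ.≤ b
frac-cancel-≤ N {a} {b} q
  with ℚᵘ.≤-respʳ-≃ (toℚᵘ-frac b N) (ℚᵘ.≤-respˡ-≃ (toℚᵘ-frac a N) (ℚ.toℚᵘ-mono-≤ q))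
... | *≤* a*N≤b*N = drop‿+≤+ (ℤ.*-cancelʳ-≤-pos (+ a) (+ b) (+ suc N) a*N≤b*N)

frac-0 : ∀ N → frac 0 N ≡ 0ℚ
frac-0 zero    = refl
frac-0 (suc N) = ℚ.0/n≡0 (suc N)

frac-N-N : ∀ N → frac (suc N) (suc N) ≡ 1ℚ
frac-N-N N = ℚ.toℚᵘ-injective (ℚᵘ.≃-trans (toℚᵘ-frac (suc N) N) (*≡* (ℤ.*-comm (+ suc N) (+ 1))))

0<p⇒p≰frac0 : ∀ {p} N → 0ℚ < p → ¬ p ≤ frac 0 N
0<p⇒p≰frac0 N 0<p p≤0 = ℚ.<-irrefl refl (ℚ.<-≤-trans 0<p (subst (_ ≤_) (frac-0 N) p≤0))

frac-gap : ∀ {p a b} N → a ℕ.< b → frac b (suc N) ≤ p → ¬ p ≤ frac a (suc N)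
frac-gap N a<b b≤p p≤a = ℕ.<⇒≱ a<b (frac-cancel-≤ N (ℚ.≤-trans b≤p p≤a))

∈-tabulate⁺ : ∀ {n} {f : Fin n → Bool} {x} → f x ≡ true → x ∈ tabulate f
∈-tabulate⁺ {f = f} {x} fx = lookup⇒[]= x _ (trans (lookup∘tabulate f x) fx)

∈-tabulate⁻ : ∀ {n} {f : Fin n → Bool} {x} → x ∈ tabulate f → f x ≡ true
∈-tabulate⁻ {f = f} {x} x∈ = trans (sym (lookup∘tabulate f x)) ([]=⇒lookup x∈)

tabulate-const : ∀ {n} (b : Bool) → tabulate {n = n} (const b) ≡ replicate n b
tabulate-const b = trans (tabulate-∘ (const b) (λ i → i)) (map-const _ b)

⁅x⁆≡tabulate : ∀ {n} (x : Fin n) → ⁅ x ⁆ ≡ tabulate (λ y → toℕ x ≡ᵇ toℕ y)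
⁅x⁆≡tabulate zero    = cong (true ∷_) (sym (tabulate-const false))
⁅x⁆≡tabulate (suc x) = cong (false ∷_) (⁅x⁆≡tabulate x)

tabulate-↑ˡ-↑ʳ : ∀ {A : Set} m {n} (f : Fin (m + n) → A) →
                 tabulate f ≡ tabulate (f ∘ (_↑ˡ n)) ++ tabulate (f ∘ (m ↑ʳ_))
tabulate-↑ˡ-↑ʳ zero    f = refl
tabulate-↑ˡ-↑ʳ (suc m) f = cong (f zero ∷_) (tabulate-↑ˡ-↑ʳ m (f ∘ suc))

∣p++q∣≡∣p∣+∣q∣ : ∀ {m n} (p : Subset m) (q : Subset n) → ∣ p ++ q ∣ ≡ ∣ p ∣ + ∣ q ∣
∣p++q∣≡∣p∣+∣q∣ []          q = refl
∣p++q∣≡∣p∣+∣q∣ (true  ∷ p) q = cong suc (∣p++q∣≡∣p∣+∣q∣ p q)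
∣p++q∣≡∣p∣+∣q∣ (false ∷ p) q = ∣p++q∣≡∣p∣+∣q∣ p q

∣p∪q∣≤∣p∣+∣q∣ : ∀ {n} (p q : Subset n) → ∣ p ∪ q ∣ ℕ.≤ ∣ p ∣ + ∣ q ∣
∣p∪q∣≤∣p∣+∣q∣ []          []          = z≤n
∣p∪q∣≤∣p∣+∣q∣ (true  ∷ p) (true  ∷ q) =
  s≤s (ℕ.≤-trans (∣p∪q∣≤∣p∣+∣q∣ p q) (ℕ.+-monoʳ-≤ ∣ p ∣ (ℕ.n≤1+n _)))
∣p∪q∣≤∣p∣+∣q∣ (true  ∷ p) (false ∷ q) = s≤s (∣p∪q∣≤∣p∣+∣q∣ p q)
∣p∪q∣≤∣p∣+∣q∣ (false ∷ p) (true  ∷ q) =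
  ℕ.≤-trans (s≤s (∣p∪q∣≤∣p∣+∣q∣ p q)) (ℕ.≤-reflexive (sym (ℕ.+-suc ∣ p ∣ ∣ q ∣)))
∣p∪q∣≤∣p∣+∣q∣ (false ∷ p) (false ∷ q) = ∣p∪q∣≤∣p∣+∣q∣ p q

x∈p⇒⁅x⁆⊆p : ∀ {n} {p : Subset n} {x} → x ∈ p → ⁅ x ⁆ ⊆ p
x∈p⇒⁅x⁆⊆p {x = x} x∈p y∈⁅x⁆ = subst (_∈ _) (sym (x∈⁅y⁆⇒x≡y x y∈⁅x⁆)) x∈p

x∈p⇒1≤∣p∣ : ∀ {n} {p : Subset n} {x} → x ∈ p → 1 ℕ.≤ ∣ p ∣
x∈p⇒1≤∣p∣ {x = x} x∈p = subst (ℕ._≤ _) (∣⁅x⁆∣≡1 x) (p⊆q⇒∣p∣≤∣q∣ (x∈p⇒⁅x⁆⊆p x∈p))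

x∈p∧∣p∣≤1⇒p⊆⁅x⁆ : ∀ {n} {p : Subset n} {x} → x ∈ p → ∣ p ∣ ℕ.≤ 1 → p ⊆ ⁅ x ⁆
x∈p∧∣p∣≤1⇒p⊆⁅x⁆ {p = p} {x} x∈p ∣p∣≤1 {y} y∈p with y ≟ x
... | yes refl = x∈⁅x⁆ x
... | no  y≢x  = ⊥-elim (ℕ.<⇒≱ 1<∣p∣ ∣p∣≤1)
  where
  1<∣p∣ : 1 ℕ.< ∣ p ∣
  1<∣p∣ = subst (ℕ._< _) (∣⁅x⁆∣≡1 x) (p⊂q⇒∣p∣<∣q∣ (x∈p⇒⁅x⁆⊆p x∈p , y , y∈p , x≢y⇒x∉⁅y⁆ y≢x))

∣Empty∣≡0 : ∀ {n} {p : Subset n} → Empty p → ∣ p ∣ ≡ 0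
∣Empty∣≡0 {n} ∅ = trans (cong ∣_∣ (Empty-unique ∅)) (∣⊥∣≡0 n)

+-cancelˡ-≡ᵇ : ∀ m a b → (m + a ≡ᵇ m + b) ≡ (a ≡ᵇ b)
+-cancelˡ-≡ᵇ zero    a b = refl
+-cancelˡ-≡ᵇ (suc m) a b = +-cancelˡ-≡ᵇ m a b

closedAdj : ∀ {N} → Graph N → Fin N → Fin N → Bool
closedAdj G u v = (toℕ u ≡ᵇ toℕ v) ∨ G u v

module _ {N : ℕ} (G : Graph N) where

  ∈-closedNbhd⁺ : ∀ {S u v} → u ∈ S → closedAdj G u v ≡ true → v ∈ closedNbhd G S
  ∈-closedNbhd⁺ {S} {u} u∈S uv = ∈-tabulate⁺ (to T-≡ (any⁺ _ (tabulate⁺ u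
    (from T-∧ (from T-≡ ([]=⇒lookup u∈S) , from T-≡ uv)))))

  ∈-closedNbhd⁻ : ∀ {S v} → v ∈ closedNbhd G S → ∃ λ u → u ∈ S × closedAdj G u v ≡ true
  ∈-closedNbhd⁻ {S} {v} v∈ with satisfied (any⁻ _ (allFin N) (from T-≡ (∈-tabulate⁻ v∈)))
  ... | u , h with to T-∧ h
  ...   | u∈S , uv = u , lookup⇒[]= u S (to T-≡ u∈S) , to T-≡ uv

  closedNbhd-mono : ∀ {S T} → S ⊆ T → closedNbhd G S ⊆ closedNbhd G T
  closedNbhd-mono S⊆T v∈ with ∈-closedNbhd⁻ v∈
  ... | u , u∈S , uv = ∈-closedNbhd⁺ (S⊆T u∈S) uv

  closedNbhd-Empty : ∀ {S} → Empty S → Empty (closedNbhd G S)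
  closedNbhd-Empty ∅ (v , v∈) with ∈-closedNbhd⁻ v∈
  ... | u , u∈S , _ = ∅ (u , u∈S)

  closedNbhd-⁅⁆ : ∀ x → closedNbhd G ⁅ x ⁆ ≡ tabulate (closedAdj G x)
  closedNbhd-⁅⁆ x = ⊆-antisym ⊆tab (λ v∈ → ∈-closedNbhd⁺ (x∈⁅x⁆ x) (∈-tabulate⁻ v∈))
    where
    ⊆tab : closedNbhd G ⁅ x ⁆ ⊆ tabulate (closedAdj G x)
    ⊆tab v∈ with ∈-closedNbhd⁻ v∈
    ... | u , u∈⁅x⁆ , uv = ∈-tabulate⁺ (subst (λ u → closedAdj G u _ ≡ true) (x∈⁅y⁆⇒x≡y x u∈⁅x⁆) uv)

  ∣closedNbhd∣≤0 : ∀ S → ∣ S ∣ ℕ.≤ 0 → ∣ closedNbhd G S ∣ ℕ.≤ 0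
  ∣closedNbhd∣≤0 S ∣S∣≤0 = ℕ.≤-reflexive (∣Empty∣≡0 (closedNbhd-Empty {S} λ (x , x∈S) →
    ℕ.<⇒≱ (x∈p⇒1≤∣p∣ x∈S) ∣S∣≤0))

  ∣closedNbhd∣≤ : ∀ {b} → (∀ x → ∣ closedNbhd G ⁅ x ⁆ ∣ ℕ.≤ b) →
                  ∀ S → ∣ S ∣ ℕ.≤ 1 → ∣ closedNbhd G S ∣ ℕ.≤ b
  ∣closedNbhd∣≤ bound S ∣S∣≤1 with nonempty? S
  ... | yes (x , x∈S) =
    ℕ.≤-trans (p⊆q⇒∣p∣≤∣q∣ (closedNbhd-mono (x∈p∧∣p∣≤1⇒p⊆⁅x⁆ x∈S ∣S∣≤1))) (bound x)
  ... | no  ∅ = ℕ.≤-trans (ℕ.≤-reflexive (∣Empty∣≡0 (closedNbhd-Empty {S} ∅))) z≤n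

  module _ {p : ℚ} where

    PDominating-mono : ∀ S {T} → S ⊆ T → PDominating G p S → PDominating G p T
    PDominating-mono S S⊆T pd = ℚ.≤-trans pd (frac-mono-≤ N (p⊆q⇒∣p∣≤∣q∣ (closedNbhd-mono S⊆T)))

    GammaPSet-of-bound : ∀ {k b S} → (∀ T → ∣ T ∣ ℕ.≤ k → ∣ closedNbhd G T ∣ ℕ.≤ b) →
                         ¬ p ≤ frac b N → PDominating G p S → ∣ S ∣ ℕ.≤ suc k → GammaPSet G p S
    GammaPSet-of-bound small p≰b pd ∣S∣≤ = pd , λ T pdT →
      ℕ.≤-trans ∣S∣≤ (ℕ.≰⇒> λ ∣T∣≤k → p≰b (ℚ.≤-trans pdT (frac-mono-≤ N (small T ∣T∣≤k))))

    GammaPSet-⁅⁆ : ∀ x → ¬ p ≤ frac 0 N → PDominating G p ⁅ x ⁆ → GammaPSet G p ⁅ x ⁆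
    GammaPSet-⁅⁆ x p≰0 pd =
      GammaPSet-of-bound {S = ⁅ x ⁆} ∣closedNbhd∣≤0 p≰0 pd (ℕ.≤-reflexive (∣⁅x⁆∣≡1 x))

    GammaPSet-pair : ∀ {b} x y → (∀ z → ∣ closedNbhd G ⁅ z ⁆ ∣ ℕ.≤ b) → ¬ p ≤ frac b N →
                     PDominating G p (⁅ x ⁆ ∪ ⁅ y ⁆) → GammaPSet G p (⁅ x ⁆ ∪ ⁅ y ⁆)
    GammaPSet-pair x y bound p≰b pd =
      GammaPSet-of-bound {S = ⁅ x ⁆ ∪ ⁅ y ⁆} (∣closedNbhd∣≤ bound) p≰b pd
        (ℕ.≤-trans (∣p∪q∣≤∣p∣+∣q∣ ⁅ x ⁆ ⁅ y ⁆) (ℕ.≤-reflexive (cong₂ _+_ (∣⁅x⁆∣≡1 x) (∣⁅x⁆∣≡1 y))))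

    GammaPSet⇒PDominating-⁅⁆ : ∀ w {S x} → PDominating G p ⁅ w ⁆ → GammaPSet G p S → x ∈ S →
                               PDominating G p ⁅ x ⁆
    GammaPSet⇒PDominating-⁅⁆ w {S} pd⁅w⁆ (pdS , minimal) x∈S = PDominating-mono S
      (x∈p∧∣p∣≤1⇒p⊆⁅x⁆ x∈S (subst (_ ℕ.≤_) (∣⁅x⁆∣≡1 w) (minimal ⁅ w ⁆ pd⁅w⁆))) pdS

PDominating-⊤ : ∀ {N p} (G : Graph (suc N)) S → p ≤ 1ℚ → closedNbhd G S ≡ ⊤ → PDominating G p S
PDominating-⊤ {N} G S p≤1 N[S]≡⊤ = subst (_ ≤_) (sym frac-N[S]≡1) p≤1
  where
  open ≡-Reasoning
  frac-N[S]≡1 : frac ∣ closedNbhd G S ∣ (suc N) ≡ 1ℚ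
  frac-N[S]≡1 = begin
    frac (∣ closedNbhd G S ∣) (suc N) ≡⟨ cong (λ S → frac ∣ S ∣ (suc N)) N[S]≡⊤ ⟩
    frac (∣ ⊤ {suc N} ∣) (suc N)      ≡⟨ cong (λ k → frac k (suc N)) (∣⊤∣≡n (suc N)) ⟩
    frac (suc N) (suc N)              ≡⟨ frac-N-N N ⟩
    1ℚ                                ∎

data Side (m n : ℕ) : Fin (m + n) → Set where
  left  : (i : Fin m) → Side m n (i ↑ˡ n)
  right : (j : Fin n) → Side m n (m ↑ʳ j)

side : ∀ m n (v : Fin (m + n)) → Side m n v
side m n v with splitAt m v in eq
... | inj₁ i = subst (Side m n) (splitAt⁻¹-↑ˡ eq) (left i)
... | inj₂ j = subst (Side m n) (splitAt⁻¹-↑ʳ eq) (right j)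

module _ {m n : ℕ} where

  InV₁-↑ˡ : (i : Fin m) → InV₁ m n (i ↑ˡ n)
  InV₁-↑ˡ i = subst (ℕ._< m) (sym (toℕ-↑ˡ i n)) (toℕ<n i)

  InV₂-↑ʳ : (j : Fin n) → InV₂ m n (m ↑ʳ j)
  InV₂-↑ʳ j = subst (m ℕ.≤_) (sym (toℕ-↑ʳ m j)) (ℕ.m≤m+n m (toℕ j))

  InV₁⊎InV₂ : ∀ v → InV₁ m n v ⊎ InV₂ m n v
  InV₁⊎InV₂ v with side m n v
  ... | left  i = inj₁ (InV₁-↑ˡ i)
  ... | right j = inj₂ (InV₂-↑ʳ j)

  inV₁ᵇ-↑ˡ : (i : Fin m) → inV₁ᵇ m (i ↑ˡ n) ≡ true
  inV₁ᵇ-↑ˡ i = to T-≡ (ℕ.<⇒<ᵇ (InV₁-↑ˡ i))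

  inV₁ᵇ-↑ʳ : (j : Fin n) → inV₁ᵇ m (m ↑ʳ j) ≡ false
  inV₁ᵇ-↑ʳ j = ¬-not λ lt → ℕ.≤⇒≯ (InV₂-↑ʳ j) (ℕ.<ᵇ⇒< _ _ (from T-≡ lt))

  closedAdj-K-↑ˡ-↑ˡ : (i i′ : Fin m) → closedAdj (K m n) (i ↑ˡ n) (i′ ↑ˡ n) ≡ (toℕ i ≡ᵇ toℕ i′)
  closedAdj-K-↑ˡ-↑ˡ i i′ = trans
    (cong₂ _∨_ (cong₂ _≡ᵇ_ (toℕ-↑ˡ i n) (toℕ-↑ˡ i′ n)) (cong₂ _xor_ (inV₁ᵇ-↑ˡ i) (inV₁ᵇ-↑ˡ i′)))
    (∨-identityʳ _)

  closedAdj-K-↑ˡ-↑ʳ : (i : Fin m) (j : Fin n) → closedAdj (K m n) (i ↑ˡ n) (m ↑ʳ j) ≡ true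
  closedAdj-K-↑ˡ-↑ʳ i j = trans (cong₂ _∨_ refl (cong₂ _xor_ (inV₁ᵇ-↑ˡ i) (inV₁ᵇ-↑ʳ j))) (∨-zeroʳ _)

  closedAdj-K-↑ʳ-↑ˡ : (j : Fin n) (i : Fin m) → closedAdj (K m n) (m ↑ʳ j) (i ↑ˡ n) ≡ true
  closedAdj-K-↑ʳ-↑ˡ j i = trans (cong₂ _∨_ refl (cong₂ _xor_ (inV₁ᵇ-↑ʳ j) (inV₁ᵇ-↑ˡ i))) (∨-zeroʳ _)

  closedAdj-K-↑ʳ-↑ʳ : (j j′ : Fin n) → closedAdj (K m n) (m ↑ʳ j) (m ↑ʳ j′) ≡ (toℕ j ≡ᵇ toℕ j′)
  closedAdj-K-↑ʳ-↑ʳ j j′ = trans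
    (cong₂ _∨_ (trans (cong₂ _≡ᵇ_ (toℕ-↑ʳ m j) (toℕ-↑ʳ m j′)) (+-cancelˡ-≡ᵇ m _ _))
               (cong₂ _xor_ (inV₁ᵇ-↑ʳ j) (inV₁ᵇ-↑ʳ j′)))
    (∨-identityʳ _)

  closedNbhd-K-↑ˡ : (i : Fin m) → closedNbhd (K m n) ⁅ i ↑ˡ n ⁆ ≡ ⁅ i ⁆ ++ ⊤
  closedNbhd-K-↑ˡ i = begin
    closedNbhd (K m n) ⁅ i ↑ˡ n ⁆
      ≡⟨ closedNbhd-⁅⁆ (K m n) (i ↑ˡ n) ⟩
    tabulate (closedAdj (K m n) (i ↑ˡ n))
      ≡⟨ tabulate-↑ˡ-↑ʳ m (closedAdj (K m n) (i ↑ˡ n)) ⟩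
    tabulate (λ i′ → closedAdj (K m n) (i ↑ˡ n) (i′ ↑ˡ n)) ++
    tabulate (λ j → closedAdj (K m n) (i ↑ˡ n) (m ↑ʳ j))
      ≡⟨ cong₂ _++_ (trans (tabulate-cong (closedAdj-K-↑ˡ-↑ˡ i)) (sym (⁅x⁆≡tabulate i)))
                    (trans (tabulate-cong (closedAdj-K-↑ˡ-↑ʳ i)) (tabulate-const true)) ⟩
    ⁅ i ⁆ ++ ⊤ ∎
    where open ≡-Reasoning

  closedNbhd-K-↑ʳ : (j : Fin n) → closedNbhd (K m n) ⁅ m ↑ʳ j ⁆ ≡ ⊤ ++ ⁅ j ⁆
  closedNbhd-K-↑ʳ j = begin
    closedNbhd (K m n) ⁅ m ↑ʳ j ⁆
      ≡⟨ closedNbhd-⁅⁆ (K m n) (m ↑ʳ j) ⟩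
    tabulate (closedAdj (K m n) (m ↑ʳ j))
      ≡⟨ tabulate-↑ˡ-↑ʳ m (closedAdj (K m n) (m ↑ʳ j)) ⟩
    tabulate (λ i → closedAdj (K m n) (m ↑ʳ j) (i ↑ˡ n)) ++
    tabulate (λ j′ → closedAdj (K m n) (m ↑ʳ j) (m ↑ʳ j′))
      ≡⟨ cong₂ _++_ (trans (tabulate-cong (closedAdj-K-↑ʳ-↑ˡ j)) (tabulate-const true))
                    (trans (tabulate-cong (closedAdj-K-↑ʳ-↑ʳ j)) (sym (⁅x⁆≡tabulate j))) ⟩
    ⊤ ++ ⁅ j ⁆ ∎
    where open ≡-Reasoning

  ∣closedNbhd-K-↑ˡ∣ : (i : Fin m) → ∣ closedNbhd (K m n) ⁅ i ↑ˡ n ⁆ ∣ ≡ 1 + n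
  ∣closedNbhd-K-↑ˡ∣ i = begin
    ∣ closedNbhd (K m n) ⁅ i ↑ˡ n ⁆ ∣ ≡⟨ cong ∣_∣ (closedNbhd-K-↑ˡ i) ⟩
    ∣ ⁅ i ⁆ ++ ⊤ ∣                    ≡⟨ ∣p++q∣≡∣p∣+∣q∣ ⁅ i ⁆ ⊤ ⟩
    ∣ ⁅ i ⁆ ∣ + ∣ ⊤ {n} ∣             ≡⟨ cong₂ _+_ (∣⁅x⁆∣≡1 i) (∣⊤∣≡n n) ⟩
    1 + n                             ∎
    where open ≡-Reasoning

  ∣closedNbhd-K-↑ʳ∣ : (j : Fin n) → ∣ closedNbhd (K m n) ⁅ m ↑ʳ j ⁆ ∣ ≡ m + 1
  ∣closedNbhd-K-↑ʳ∣ j = begin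
    ∣ closedNbhd (K m n) ⁅ m ↑ʳ j ⁆ ∣ ≡⟨ cong ∣_∣ (closedNbhd-K-↑ʳ j) ⟩
    ∣ ⊤ {m} ++ ⁅ j ⁆ ∣                ≡⟨ ∣p++q∣≡∣p∣+∣q∣ (⊤ {m}) ⁅ j ⁆ ⟩
    ∣ ⊤ {m} ∣ + ∣ ⁅ j ⁆ ∣             ≡⟨ cong₂ _+_ (∣⊤∣≡n m) (∣⁅x⁆∣≡1 j) ⟩
    m + 1                             ∎
    where open ≡-Reasoning

  ∣closedNbhd-K-⁅⁆∣≤ : n ℕ.≤ m → ∀ v → ∣ closedNbhd (K m n) ⁅ v ⁆ ∣ ℕ.≤ m + 1
  ∣closedNbhd-K-⁅⁆∣≤ n≤m v with side m n v
  ... | left  i = subst (ℕ._≤ m + 1) (sym (∣closedNbhd-K-↑ˡ∣ i))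
                    (ℕ.≤-trans (ℕ.≤-reflexive (ℕ.+-comm 1 n)) (ℕ.+-monoˡ-≤ 1 n≤m))
  ... | right j = ℕ.≤-reflexive (∣closedNbhd-K-↑ʳ∣ j)

  ∣closedNbhd-K-⁅⁆∣≥ : n ℕ.≤ m → ∀ v → n + 1 ℕ.≤ ∣ closedNbhd (K m n) ⁅ v ⁆ ∣
  ∣closedNbhd-K-⁅⁆∣≥ n≤m v with side m n v
  ... | left  i = ℕ.≤-reflexive (trans (ℕ.+-comm n 1) (sym (∣closedNbhd-K-↑ˡ∣ i)))
  ... | right j = subst (n + 1 ℕ.≤_) (sym (∣closedNbhd-K-↑ʳ∣ j)) (ℕ.+-monoˡ-≤ 1 n≤m)

  closedNbhd-K-pair : (i : Fin m) (j : Fin n) → closedNbhd (K m n) (⁅ i ↑ˡ n ⁆ ∪ ⁅ m ↑ʳ j ⁆) ≡ ⊤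
  closedNbhd-K-pair i j = ⊆-antisym ⊆⊤ (λ {v} _ → covered v)
    where
    covered : ∀ v → v ∈ closedNbhd (K m n) (⁅ i ↑ˡ n ⁆ ∪ ⁅ m ↑ʳ j ⁆)
    covered v with side m n v
    ... | left  i′ = ∈-closedNbhd⁺ (K m n) (x∈p∪q⁺ {p = ⁅ i ↑ˡ n ⁆} (inj₂ (x∈⁅x⁆ _)))
                                   (closedAdj-K-↑ʳ-↑ˡ j i′)
    ... | right j′ = ∈-closedNbhd⁺ (K m n) (x∈p∪q⁺ {p = ⁅ i ↑ˡ n ⁆} (inj₁ (x∈⁅x⁆ _)))
                                   (closedAdj-K-↑ˡ-↑ʳ i j′)

influencing-⁅⁆ : ∀ {m n p} → n ℕ.≤ m → 0ℚ < p → p ≤ frac (n + 1) (m + n) →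
                 ∀ v → InInfluencing (K m n) p v
influencing-⁅⁆ {m} {n} {p} n≤m 0<p p≤ v =
  ⁅ v ⁆ , GammaPSet-⁅⁆ (K m n) v (0<p⇒p≰frac0 (m + n) 0<p) pd , x∈⁅x⁆ v
  where
  pd : PDominating (K m n) p ⁅ v ⁆
  pd = ℚ.≤-trans p≤ (frac-mono-≤ (m + n) (∣closedNbhd-K-⁅⁆∣≥ n≤m v))

GammaPSet-K-pair : ∀ {m n p} → n ℕ.≤ m → p ≤ 1ℚ → ¬ p ≤ frac (m + 1) (m + n) →
                   (i : Fin m) (j : Fin n) → GammaPSet (K m n) p (⁅ i ↑ˡ n ⁆ ∪ ⁅ m ↑ʳ j ⁆)
GammaPSet-K-pair {suc m} {n} n≤m p≤1 p≰ i j =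
  GammaPSet-pair (K (suc m) n) (i ↑ˡ n) (suc m ↑ʳ j) (∣closedNbhd-K-⁅⁆∣≤ n≤m) p≰
    (PDominating-⊤ (K (suc m) n) (⁅ i ↑ˡ n ⁆ ∪ ⁅ suc m ↑ʳ j ⁆) p≤1 (closedNbhd-K-pair i j))

influencing-pair : ∀ {m n p} → Fin m → Fin n → n ℕ.≤ m → p ≤ 1ℚ → ¬ p ≤ frac (m + 1) (m + n) →
                   ∀ v → InInfluencing (K m n) p v
influencing-pair {m} {n} i₀ j₀ n≤m p≤1 p≰ v with side m n v
... | left  i = ⁅ i ↑ˡ n ⁆ ∪ ⁅ m ↑ʳ j₀ ⁆ , GammaPSet-K-pair n≤m p≤1 p≰ i j₀ ,
                x∈p∪q⁺ (inj₁ (x∈⁅x⁆ _))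
... | right j = ⁅ i₀ ↑ˡ n ⁆ ∪ ⁅ m ↑ʳ j ⁆ , GammaPSet-K-pair n≤m p≤1 p≰ i₀ j ,
                x∈p∪q⁺ {p = ⁅ i₀ ↑ˡ n ⁆} (inj₂ (x∈⁅x⁆ _))

module _ {m n : ℕ} {p : ℚ} (p≤m+1 : p ≤ frac (m + 1) (m + n))
                           (p≰n+1 : ¬ p ≤ frac (n + 1) (m + n)) where

  PDominating-K-↑ʳ : (j : Fin n) → PDominating (K m n) p ⁅ m ↑ʳ j ⁆
  PDominating-K-↑ʳ j = subst (λ k → p ≤ frac k (m + n)) (sym (∣closedNbhd-K-↑ʳ∣ j)) p≤m+1

  ¬PDominating-K-↑ˡ : (i : Fin m) → ¬ PDominating (K m n) p ⁅ i ↑ˡ n ⁆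
  ¬PDominating-K-↑ˡ i pd =
    p≰n+1 (subst (λ k → p ≤ frac k (m + n)) (trans (∣closedNbhd-K-↑ˡ∣ i) (ℕ.+-comm 1 n)) pd)

  influencing⇔InV₂ : Fin n → ∀ v → InInfluencing (K m n) p v ⇔ InV₂ m n v
  influencing⇔InV₂ j₀ v = mk⇔ (influencing⇒InV₂ v) (InV₂⇒influencing v)
    where
    influencing⇒InV₂ : ∀ v → InInfluencing (K m n) p v → InV₂ m n v
    influencing⇒InV₂ v (S , γ , v∈S) with side m n v
    ... | left  i = ⊥-elim (¬PDominating-K-↑ˡ i
                      (GammaPSet⇒PDominating-⁅⁆ (K m n) (m ↑ʳ j₀) (PDominating-K-↑ʳ j₀) γ v∈S))
    ... | right j = InV₂-↑ʳ j

    p≰0 : ¬ p ≤ frac 0 (m + n)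
    p≰0 p≤0 = p≰n+1 (ℚ.≤-trans p≤0 (frac-mono-≤ (m + n) z≤n))

    InV₂⇒influencing : ∀ v → InV₂ m n v → InInfluencing (K m n) p v
    InV₂⇒influencing v v∈V₂ with side m n v
    ... | left  i = ⊥-elim (ℕ.<⇒≱ (InV₁-↑ˡ i) v∈V₂)
    ... | right j = ⁅ m ↑ʳ j ⁆ , GammaPSet-⁅⁆ (K m n) (m ↑ʳ j) p≰0 (PDominating-K-↑ʳ j) , x∈⁅x⁆ _

influencing-balanced : ∀ {n p} → Fin n → 0ℚ < p → p ≤ 1ℚ → ∀ v → InInfluencing (K n n) p v
influencing-balanced {n} {p} j₀ 0<p p≤1 v with p ℚ.≤? frac (n + 1) (n + n)
... | yes p≤n+1 = influencing-⁅⁆ {n} {n} ℕ.≤-refl 0<p p≤n+1 v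
... | no  p≰n+1 = influencing-pair {n} {n} j₀ j₀ ℕ.≤-refl p≤1 p≰n+1 v

influencing⇔InV₁⊎InV₂ : ∀ {m n p} → (∀ v → InInfluencing (K m n) p v) →
                        ∀ v → InInfluencing (K m n) p v ⇔ (InV₁ m n v ⊎ InV₂ m n v)
influencing⇔InV₁⊎InV₂ everywhere v = mk⇔ (λ _ → InV₁⊎InV₂ v) (λ _ → everywhere v)

m+1<m+2 : ∀ m → m + 1 ℕ.< m + 2
m+1<m+2 m = ℕ.+-monoʳ-< m (ℕ.n<1+n 1)

mainTheorem13 :
    ((m n : ℕ) → 1 ℕ.≤ n → n ℕ.< m → (p : ℚ) →
      (((0ℚ < p × p ≤ frac (n + 1) (m + n)) ⊎ (frac (m + 2) (m + n) ≤ p × p ≤ 1ℚ)) →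
        (v : Fin (m + n)) → InInfluencing (K m n) p v ⇔ (InV₁ m n v ⊎ InV₂ m n v))
      × ((frac (n + 2) (m + n) ≤ p × p ≤ frac (m + 1) (m + n)) →
        (v : Fin (m + n)) → InInfluencing (K m n) p v ⇔ InV₂ m n v))
    × ((n : ℕ) → 1 ℕ.≤ n → (p : ℚ) → 0ℚ < p → p ≤ 1ℚ →
        (v : Fin (n + n)) → InInfluencing (K n n) p v ⇔ (InV₁ n n v ⊎ InV₂ n n v))
mainTheorem13 =
    (λ where
      zero      _         _ ()  _
      (suc _)   zero      () _  _
      M@(suc _) N@(suc _) _ N<M _ →
          (λ where
            (inj₁ (0<p , p≤N+1)) → influencing⇔InV₁⊎InV₂ (influencing-⁅⁆ (ℕ.<⇒≤ N<M) 0<p p≤N+1)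
            (inj₂ (M+2≤p , p≤1)) → influencing⇔InV₁⊎InV₂
              (influencing-pair zero zero (ℕ.<⇒≤ N<M) p≤1 (frac-gap _ (m+1<m+2 M) M+2≤p)))
        , λ (N+2≤p , p≤M+1) → influencing⇔InV₂ p≤M+1 (frac-gap _ (m+1<m+2 N) N+2≤p) zero)
  , (λ where
      zero    ()
      (suc _) _ _ 0<p p≤1 → influencing⇔InV₁⊎InV₂ (influencing-balanced zero 0<p p≤1))
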